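{- Let $\Sigma$ be a finite alphabet of size $\sigma\ge 2$ and $k\ge 2$. Every weakly connected component of the MDS graph $G_{\mathrm{MDS}}(\sigma,k)$ satisfies: (1) it is strongly connected; (2) every directed cycle in it has length $\alpha\sigma^{k-1}$ for some positive integer $\alpha$; (3) in a directed cycle of length $\alpha\sigma^{k-1}$, every F-move $f\in\Sigma^{k-1}$ occurs as an edge label exactly $\alpha$ times; (4) every node lies on a directed cycle of length $\sigma^{k-1}$ (hence the girth is $\sigma^{k-1}$); (5) it is a $\sigma^{k-1}$-partite directed graph.
   Context: The de Bruijn graph $D_k$ has vertex set $\Sigma^k$ and a directed edge $u\to v$ whenever the length-$(k-1)$ suffix of $u$ equals the length-$(k-1)$ prefix of $v$. A set $M\subseteq\Sigma^k$ is decycling if $D_k\setminus M$ has no directed cycle; a minimum decycling set (MDS) is a decycling set of minimum cardinality. For $f\in\Sigma^{k-1}$, $\mathrm{lc}(f)=\{af:a\in\Sigma\}$ and $\mathrm{rc}(f)=\{fa:a\in\Sigma\}$. The F-move $f$ is valid in $M$ if $\mathrm{lc}(f)\subseteq M$, and then $fM=(M\setminus\mathrm{lc}(f))\cup\mathrm{rc}(f)$ (which is again an MDS when $M$ is). The MDS graph $G_{\mathrm{MDS}}(\sigma,k)$ has as nodes all MDSs of $D_k$ and, for each MDS $M$ and each F-move $f$ valid in $M$, a directed edge $M\to fM$ labeled $f$. -}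

module Defs where

open import Data.Nat using (ℕ; zero; suc; _≤_)
open import Data.Bool using (Bool; true; false; if_then_else_)
open import Data.Fin using (Fin)
open import Data.Fin.Properties using () renaming (_≟_ to _≟F_)
open import Data.Vec using (Vec; []; _∷_; tail; init)
open import Data.Vec.Properties using (≡-dec)
open import Data.List using (List; []; _∷_; _++_; [_]; map; concatMap; length; filter)
open import Data.List.Relation.Unary.All using (All)
open import Data.List.Relation.Unary.AllPairs using (AllPairs)
open import Data.List.Relation.Unary.Linked using (Linked)
open import Data.List.Relation.Unary.Unique.Propositional using (Unique)
open import Data.Empty using (⊥)
open import Relation.Nullary using (¬_; does)
open import Relation.Binary.PropositionalEquality using (_≡_)
open import Data.Product using (_×_; Σ)
open import Data.Nat.ListAction using (sum)

allWords : (σ m : ℕ) → List (Vec (Fin σ) m)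
allWords σ zero = [ [] ]
allWords σ (suc m) = concatMap (λ a → map (a ∷_) (allWords σ m)) (Data.List.allFin σ)

-- Throughout: alphabet Σ = Fin σ, word length k = suc n, F-moves have length n = k - 1.
module _ (σ n : ℕ) where

  Word : Set
  Word = Vec (Fin σ) (suc n)

  FMove : Set
  FMove = Vec (Fin σ) n

  WSet : Set
  WSet = Word → Bool

  _≈_ : WSet → WSet → Set
  M ≈ M' = ∀ w → M w ≡ M' w

  DBEdge : Word → Word → Set
  DBEdge u v = tail u ≡ init v

  Decycling : WSet → Set
  Decycling M = ∀ (v : Word) (vs : List Word) →
    Linked DBEdge (v ∷ vs ++ [ v ]) → Unique (v ∷ vs) →
    All (λ w → M w ≡ false) (v ∷ vs) → ⊥

  card : WSet → ℕ
  card M = sum (map (λ w → if M w then 1 else 0) (allWords σ (suc n)))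

  IsMDS : WSet → Set
  IsMDS M = Decycling M × (∀ M' → Decycling M' → card M ≤ card M')

  Valid : FMove → WSet → Set
  Valid f M = ∀ a → M (a ∷ f) ≡ true

  -- fM = (M \ lc(f)) ∪ rc(f);  w ∈ rc(f) iff init w = f, w ∈ lc(f) iff tail w = f
  move : FMove → WSet → WSet
  move f M w =
    if does (≡-dec _≟F_ (init w) f) then true
    else if does (≡-dec _≟F_ (tail w) f) then false
    else M w

  -- directed walk in the MDS graph from M to M' with label sequence fs
  -- (nodes are sets up to extensional equality)
  data Walk : WSet → WSet → List FMove → Set where
    done : ∀ {M M'} → M ≈ M' → Walk M M' []
    step : ∀ {M M' fs} (f : FMove) → Valid f M → Walk (move f M) M' fs → Walk M M' (f ∷ fs)

  nodes : ∀ {M M' fs} → Walk M M' fs → List WSet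
  nodes (done _) = []
  nodes {M} (step f _ w) = M ∷ nodes w

  Cycle : WSet → List FMove → Set
  Cycle M fs = Σ (Walk M M fs) λ w → (¬ fs ≡ []) × AllPairs (λ A B → ¬ A ≈ B) (nodes w)

  data Conn : WSet → WSet → Set where
    here : ∀ {M M'} → M ≈ M' → Conn M M'
    fwd  : ∀ {M M''} (f : FMove) → Valid f M → IsMDS (move f M) →
           Conn (move f M) M'' → Conn M M''
    bwd  : ∀ {M M''} (f : FMove) (M' : WSet) → IsMDS M' → Valid f M' →
           M ≈ move f M' → Conn M' M'' → Conn M M''

  InComp : WSet → WSet → Set
  InComp M₀ M = IsMDS M × Conn M₀ M

  occ : FMove → List FMove → ℕ
  occ f fs = length (filter (λ g → ≡-dec _≟F_ g f) fs)

{-# OPTIONS --safe #-}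
module Submission where

-- If a word of rc(f) ∖ lc(f) already lay in an
-- MDS M, the move would shrink M; hence along a walk of MDSs every word w enters the set
-- once per use of the move init w and leaves it once per use of tail w. On a closed walk
-- the number of uses of a move is therefore invariant under the shift f ↦ tail (f ∷ʳ a),
-- so all σ^(k-1) moves are used equally often. Conversely, applying unused moves greedily
-- never gets stuck before every move has been used once, and using every move once leads
-- back to the start: this gives a cycle of length σ^(k-1) through every node and a way
-- back along every edge. For the colouring, the words are weighted by a flow along a
-- spanning in-tree of D_(k-1); the weight of the set then grows by 1 modulo σ^(k-1) at
-- every move.

open import Defs
open import Data.Nat
  using (ℕ; zero; suc; _+_; _*_; _^_; _≤_; _<_; z≤n; s≤s; NonZero; _%_; _≟_; ≢-nonZero⁻¹; >-nonZero)
open import Data.Nat.Properties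
open import Data.Nat.DivMod using (_mod_; m%n<n; [m+kn]%n≡m%n; %-distribˡ-+; m<n⇒m%n≡m; n%n≡0)
open import Data.Nat.ListAction using (sum)
open import Data.Nat.Tactic.RingSolver using (solve-∀)
open import Algebra.Properties.CommutativeSemigroup +-commutativeSemigroup
  using () renaming ( interchange to +-interchange; xy∙z≈xz∙y to +-right-comm
                    ; xy∙z≈y∙zx to +-rotate; xy∙z≈zx∙y to +-swap-last)
open import Data.Bool using (Bool; true; false; if_then_else_; _∧_; not)
open import Data.Bool.Properties using (¬-not) renaming (_≟_ to _≟ᵇ_)
open import Data.Fin using (Fin) renaming (zero to fzero; suc to fsuc)
open import Data.Fin.Properties using (all?; ¬∀⟶∃¬; fromℕ<-injective) renaming (_≟_ to _≟ᶠ_)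
open import Data.Vec using (Vec; []; _∷_; tail; init; last; _∷ʳ_)
open import Data.Vec.Properties using (≡-dec; init-∷ʳ; last-∷ʳ)
open import Data.List using (List; []; _∷_; _++_; [_]; map; concatMap; length; allFin; filter)
open import Data.List.Properties
  using (length-++; ++-identityʳ; ++-assoc; map-tabulate; length-tabulate; filter-++)
open import Data.List.Membership.Propositional using (_∈_; lose)
open import Data.List.Membership.Propositional.Properties
  using (∈-map⁺; ∈-++⁺ˡ; ∈-++⁺ʳ; ∈-++⁻; ∈-∃++; ∈-concatMap⁺; ∈-tabulate⁺)
open import Data.List.Membership.DecPropositional using () renaming (_∈?_ to ∈-dec)
open import Data.List.Relation.Binary.Subset.Propositional using (_⊆_)
open import Data.List.Relation.Unary.Any using (here; there; any?; satisfied)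
open import Data.List.Relation.Unary.All as All using (All; []; _∷_)
open import Data.List.Relation.Unary.All.Properties using (¬Any⇒All¬; ++⁻ˡ) renaming (++⁺ to All-++⁺)
open import Data.List.Relation.Unary.AllPairs using (AllPairs; []; _∷_)
open import Data.List.Relation.Unary.Linked using (Linked; []; [-]; _∷_)
open import Data.List.Relation.Unary.Unique.Propositional using (Unique)
open import Data.Product using (_×_; Σ; ∃-syntax; _,_; proj₁; proj₂)
open import Data.Sum using (inj₁; inj₂)
open import Data.Empty using (⊥; ⊥-elim)
open import Function using (_∘_; id)
open import Relation.Nullary using (¬_; Dec; yes; no; does)
open import Relation.Nullary.Decidable using (dec-true; map′; _×-dec_)
open import Relation.Binary.Definitions using (DecidableEquality)
open import Relation.Binary.PropositionalEquality
  using (_≡_; _≢_; refl; sym; trans; cong; cong₂; subst; subst₂; module ≡-Reasoning)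

∑ : {A : Set} → List A → (A → ℕ) → ℕ
∑ xs h = sum (map h xs)

[_]·_ : Bool → ℕ → ℕ
[ b ]· x = if b then x else 0

module _ {A : Set} where

  ∑-++ : ∀ (xs ys : List A) h → ∑ (xs ++ ys) h ≡ ∑ xs h + ∑ ys h
  ∑-++ []       ys h = refl
  ∑-++ (x ∷ xs) ys h = trans (cong (h x +_) (∑-++ xs ys h)) (sym (+-assoc (h x) _ _))

  ∑-cong : ∀ (xs : List A) {h k} → (∀ x → h x ≡ k x) → ∑ xs h ≡ ∑ xs k
  ∑-cong []       eq = refl
  ∑-cong (x ∷ xs) eq = cong₂ _+_ (eq x) (∑-cong xs eq)

  ∑-+ : ∀ (xs : List A) h k → ∑ xs (λ x → h x + k x) ≡ ∑ xs h + ∑ xs k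
  ∑-+ []       h k = refl
  ∑-+ (x ∷ xs) h k =
    trans (cong (h x + k x +_) (∑-+ xs h k)) (+-interchange (h x) (k x) (∑ xs h) (∑ xs k))

  ∑-* : ∀ (xs : List A) c h → ∑ xs (λ x → c * h x) ≡ c * ∑ xs h
  ∑-* []       c h = sym (*-zeroʳ c)
  ∑-* (x ∷ xs) c h = trans (cong (c * h x +_) (∑-* xs c h)) (sym (*-distribˡ-+ c (h x) _))

  ∑-const : ∀ (xs : List A) c → ∑ xs (λ _ → c) ≡ c * length xs
  ∑-const []       c = sym (*-zeroʳ c)
  ∑-const (x ∷ xs) c = trans (cong (c +_) (∑-const xs c)) (sym (*-suc c (length xs)))

  ∑-mono-≤ : ∀ (xs : List A) {h k} → (∀ x → h x ≤ k x) → ∑ xs h ≤ ∑ xs k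
  ∑-mono-≤ []       le = z≤n
  ∑-mono-≤ (x ∷ xs) le = +-mono-≤ (le x) (∑-mono-≤ xs le)

  ∑-mono-< : ∀ (xs : List A) {h k} → (∀ x → h x ≤ k x) → ∀ {y} → y ∈ xs → h y < k y →
             ∑ xs h < ∑ xs k
  ∑-mono-< (x ∷ xs) le (here refl) lt = +-mono-<-≤ lt (∑-mono-≤ xs le)
  ∑-mono-< (x ∷ xs) le (there y∈) lt = +-mono-≤-< (le x) (∑-mono-< xs le y∈ lt)

[]·-∧ : ∀ b c x → [ b ∧ c ]· x ≡ [ b ]· ([ c ]· x)
[]·-∧ false c x = refl
[]·-∧ true  c x = refl

∑-[]· : ∀ {A : Set} b (xs : List A) h → ∑ xs (λ x → [ b ]· h x) ≡ [ b ]· ∑ xs h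
∑-[]· false xs h = ∑-const xs 0
∑-[]· true  xs h = refl

∑-allFin-const : ∀ N c → ∑ (allFin N) (λ _ → c) ≡ c * N
∑-allFin-const N c = trans (∑-const (allFin N) c) (cong (c *_) (length-tabulate id))

∑-map : ∀ {A B : Set} (g : A → B) (xs : List A) h → ∑ (map g xs) h ≡ ∑ xs (h ∘ g)
∑-map g []       h = refl
∑-map g (x ∷ xs) h = cong (h (g x) +_) (∑-map g xs h)

∑-concatMap : ∀ {A B : Set} (f : A → List B) (xs : List A) h →
              ∑ (concatMap f xs) h ≡ ∑ xs (λ x → ∑ (f x) h)
∑-concatMap f []       h = refl
∑-concatMap f (x ∷ xs) h =
  trans (∑-++ (f x) (concatMap f xs) h) (cong (∑ (f x) h +_) (∑-concatMap f xs h))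

∑-allFin-suc : ∀ N (h : Fin (suc N) → ℕ) → ∑ (allFin (suc N)) h ≡ h fzero + ∑ (allFin N) (h ∘ fsuc)
∑-allFin-suc N h =
  cong (h fzero +_) (trans (cong (sum ∘ map h) (sym (map-tabulate id fsuc))) (∑-map fsuc (allFin N) h))

∑-allFin-δ : ∀ N (b : Fin N) (h : Fin N → ℕ) → ∑ (allFin N) (λ a → [ does (a ≟ᶠ b) ]· h a) ≡ h b
∑-allFin-δ (suc N) fzero h = begin
  ∑ (allFin (suc N)) _             ≡⟨ ∑-allFin-suc N _ ⟩
  h fzero + ∑ (allFin N) (λ _ → 0) ≡⟨ cong (h fzero +_) (∑-const (allFin N) 0) ⟩
  h fzero + 0                      ≡⟨ +-identityʳ (h fzero) ⟩
  h fzero                          ∎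
  where open ≡-Reasoning
∑-allFin-δ (suc N) (fsuc b) h =
  trans (∑-allFin-suc N (λ a → [ does (a ≟ᶠ fsuc b) ]· h a)) (∑-allFin-δ N b (h ∘ fsuc))

module _ {σ : ℕ} where

  infix 4 _≟ʷ_
  _≟ʷ_ : ∀ {k} → DecidableEquality (Vec (Fin σ) k)
  _≟ʷ_ = ≡-dec _≟ᶠ_

  ∈-allWords : ∀ {k} (w : Vec (Fin σ) k) → w ∈ allWords σ k
  ∈-allWords []      = here refl
  ∈-allWords {suc k} (a ∷ w) =
    ∈-concatMap⁺ (λ b → map (b ∷_) (allWords σ k)) (lose (∈-tabulate⁺ a) (∈-map⁺ (a ∷_) (∈-allWords w)))

  ∑-allWords-suc : ∀ k (h : Vec (Fin σ) (suc k) → ℕ) →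
    ∑ (allWords σ (suc k)) h ≡ ∑ (allFin σ) (λ a → ∑ (allWords σ k) (λ v → h (a ∷ v)))
  ∑-allWords-suc k h = trans (∑-concatMap (λ a → map (a ∷_) (allWords σ k)) (allFin σ) h)
    (∑-cong (allFin σ) (λ a → ∑-map (a ∷_) (allWords σ k) h))

  length-allWords : ∀ k → length (allWords σ k) ≡ σ ^ k
  length-allWords k = trans (sym (trans (∑-const (allWords σ k) 1) (*-identityˡ _))) (count k)
    where
    count : ∀ k → ∑ (allWords σ k) (λ _ → 1) ≡ σ ^ k
    count zero    = refl
    count (suc k) = begin
      ∑ (allWords σ (suc k)) (λ _ → 1)                 ≡⟨ ∑-allWords-suc k _ ⟩
      ∑ (allFin σ) (λ _ → ∑ (allWords σ k) (λ _ → 1))  ≡⟨ ∑-cong (allFin σ) (λ _ → count k) ⟩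
      ∑ (allFin σ) (λ _ → σ ^ k)                       ≡⟨ ∑-allFin-const σ (σ ^ k) ⟩
      σ ^ k * σ                                        ≡⟨ *-comm (σ ^ k) σ ⟩
      σ ^ suc k                                        ∎
      where open ≡-Reasoning

  ∑-first-letter-δ : ∀ k b (p : Vec (Fin σ) k → Bool) (h : Vec (Fin σ) (suc k) → ℕ) →
    ∑ (allFin σ) (λ a → ∑ (allWords σ k) (λ v → [ does (a ≟ᶠ b) ∧ p v ]· h (a ∷ v)))
    ≡ ∑ (allWords σ k) (λ v → [ p v ]· h (b ∷ v))
  ∑-first-letter-δ k b p h = begin
    ∑ (allFin σ) (λ a → ∑ (allWords σ k) (λ v → [ does (a ≟ᶠ b) ∧ p v ]· h (a ∷ v)))
      ≡⟨ ∑-cong (allFin σ) (λ a → ∑-cong (allWords σ k) (λ v → []·-∧ (does (a ≟ᶠ b)) (p v) _)) ⟩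
    ∑ (allFin σ) (λ a → ∑ (allWords σ k) (λ v → [ does (a ≟ᶠ b) ]· ([ p v ]· h (a ∷ v))))
      ≡⟨ ∑-cong (allFin σ) (λ a → ∑-[]· (does (a ≟ᶠ b)) (allWords σ k) _) ⟩
    ∑ (allFin σ) (λ a → [ does (a ≟ᶠ b) ]· ∑ (allWords σ k) (λ v → [ p v ]· h (a ∷ v)))
      ≡⟨ ∑-allFin-δ σ b _ ⟩
    ∑ (allWords σ k) (λ v → [ p v ]· h (b ∷ v)) ∎
    where open ≡-Reasoning

  ∑-allWords-δ : ∀ {k} (f : Vec (Fin σ) k) (h : Vec (Fin σ) k → ℕ) →
    ∑ (allWords σ k) (λ v → [ does (v ≟ʷ f) ]· h v) ≡ h f
  ∑-allWords-δ []      h = +-identityʳ (h [])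
  ∑-allWords-δ {suc k} (b ∷ f) h =
    trans (∑-allWords-suc k _) (trans (∑-first-letter-δ k b (λ v → does (v ≟ʷ f)) h)
          (∑-allWords-δ f (λ v → h (b ∷ v))))

  ∑-tail-δ : ∀ {k} (f : Vec (Fin σ) k) (h : Vec (Fin σ) (suc k) → ℕ) →
    ∑ (allWords σ (suc k)) (λ w → [ does (tail w ≟ʷ f) ]· h w) ≡ ∑ (allFin σ) (λ a → h (a ∷ f))
  ∑-tail-δ {k} f h =
    trans (∑-allWords-suc k _) (∑-cong (allFin σ) (λ a → ∑-allWords-δ f (λ v → h (a ∷ v))))

  ∑-init-δ : ∀ {k} (f : Vec (Fin σ) k) (h : Vec (Fin σ) (suc k) → ℕ) →
    ∑ (allWords σ (suc k)) (λ w → [ does (init w ≟ʷ f) ]· h w) ≡ ∑ (allFin σ) (λ a → h (f ∷ʳ a))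
  ∑-init-δ []      h = trans (∑-allWords-suc 0 _) (∑-cong (allFin σ) (λ a → +-identityʳ (h (a ∷ []))))
  ∑-init-δ {suc k} (b ∷ f) h =
    trans (∑-allWords-suc (suc k) _) (trans (∑-first-letter-δ (suc k) b (λ v → does (init v ≟ʷ f)) h)
          (∑-init-δ f (λ v → h (b ∷ v))))

shift-invariant⇒constant : ∀ {A B : Set} L (c : Vec A L → B) →
  (∀ v a → c v ≡ c (tail (v ∷ʳ a))) → ∀ u v → c u ≡ c v
shift-invariant⇒constant zero    c inv [] [] = refl
shift-invariant⇒constant (suc L) c inv (x ∷ u) (y ∷ v) =
  trans (first-letter-irrelevant x y u) (shift-invariant⇒constant L (λ v → c (y ∷ v)) inv-y u v)
  where
  first-letter-irrelevant : ∀ x y v → c (x ∷ v) ≡ c (y ∷ v)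
  first-letter-irrelevant x y v = trans (inv (x ∷ v) x) (sym (inv (y ∷ v) x))
  inv-y : ∀ v a → c (y ∷ v) ≡ c (y ∷ tail (v ∷ʳ a))
  inv-y []      a = refl
  inv-y (z ∷ v) a = trans (inv (y ∷ z ∷ v) a) (first-letter-irrelevant z y (v ∷ʳ a))

module _ {A : Set} where

  Unique-⊆⇒length≤ : ∀ {xs ys : List A} → Unique xs → xs ⊆ ys → length xs ≤ length ys
  Unique-⊆⇒length≤ {[]}     _          _  = z≤n
  Unique-⊆⇒length≤ {x ∷ xs} (x∉ ∷ uxs) xs⊆ys with ∈-∃++ (xs⊆ys (here refl))
  ... | pre , post , refl = begin
    suc (length xs)             ≤⟨ s≤s (Unique-⊆⇒length≤ uxs xs⊆pre++post) ⟩
    suc (length (pre ++ post))  ≡⟨ cong suc (length-++ pre) ⟩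
    suc (length pre + length post) ≡⟨ +-suc (length pre) (length post) ⟨
    length pre + length (x ∷ post) ≡⟨ length-++ pre ⟨
    length (pre ++ x ∷ post)    ∎
    where
    open ≤-Reasoning
    xs⊆pre++post : xs ⊆ pre ++ post
    xs⊆pre++post y∈xs with ∈-++⁻ pre (xs⊆ys (there y∈xs))
    ... | inj₁ y∈pre         = ∈-++⁺ˡ y∈pre
    ... | inj₂ (here refl)   = ⊥-elim (All.lookup x∉ y∈xs refl)
    ... | inj₂ (there y∈post) = ∈-++⁺ʳ pre y∈post

  Linked-prefix : ∀ {R : A → A → Set} (xs : List A) {y zs} →
    Linked R (xs ++ y ∷ zs) → Linked R (xs ++ [ y ])
  Linked-prefix []           _           = [-]
  Linked-prefix (x ∷ [])     (r ∷ _)     = r ∷ [-]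
  Linked-prefix (x ∷ x′ ∷ xs) (r ∷ rs)   = r ∷ Linked-prefix (x′ ∷ xs) rs

  Unique-rotate : ∀ (pre : List A) {v post} → Unique (pre ++ v ∷ post) → Unique (v ∷ pre)
  Unique-rotate []        (_ ∷ _)    = [] ∷ []
  Unique-rotate (x ∷ pre) {v} (x∉ ∷ u) with Unique-rotate pre u
  ... | v∉pre ∷ upre = (v≢x ∷ v∉pre) ∷ (++⁻ˡ pre x∉ ∷ upre)
    where
    v≢x : v ≢ x
    v≢x v≡x = All.lookup x∉ (∈-++⁺ʳ pre (here refl)) (sym v≡x)

CycleWithin : {V : Set} → (V → V → Set) → (V → Set) → Set
CycleWithin R S = ∃[ v ] ∃[ vs ] (Linked R (v ∷ vs ++ [ v ]) × Unique (v ∷ vs) × All S (v ∷ vs))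

module _ {V : Set} (_≟ᵛ_ : DecidableEquality V) {vertices : List V} (complete : ∀ v → v ∈ vertices)
         (R : V → V → Set) {S : V → Set} (predecessor : ∀ w → S w → ∃[ u ] (S u × R u w)) where

  private
    search : ∀ fuel h p → Linked R (h ∷ p) → Unique (h ∷ p) → All S (h ∷ p) →
             length vertices < fuel + length (h ∷ p) → CycleWithin R S
    search zero h p _ u _ bound =
      ⊥-elim (<⇒≱ bound (Unique-⊆⇒length≤ u (λ {v} _ → complete v)))
    search (suc fuel) h p l u s@(Sh ∷ _) bound with predecessor h Sh
    ... | v , Sv , Rvh with ∈-dec _≟ᵛ_ v (h ∷ p)
    ...   | no v∉ = search fuel v (h ∷ p) (Rvh ∷ l) (¬Any⇒All¬ _ v∉ ∷ u) (Sv ∷ s)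
                      (<-≤-trans bound (≤-reflexive (sym (+-suc fuel _))))
    ...   | yes v∈ with ∈-∃++ v∈
    ...     | pre , post , eq =
      v , pre , Linked-prefix (v ∷ pre) (subst (Linked R ∘ (v ∷_)) eq (Rvh ∷ l)) ,
      Unique-rotate pre (subst Unique eq u) , Sv ∷ ++⁻ˡ pre (subst (All S) eq s)

  predecessor-closed⇒cycle : ∀ w → S w → CycleWithin R S
  predecessor-closed⇒cycle w Sw =
    search (suc (length vertices)) w [] [-] ([] ∷ []) (Sw ∷ []) (m≤m+n (suc (length vertices)) 1)

module MDSGraph (σ n : ℕ) where

  allW : List (Word σ n)
  allW = allWords σ (suc n)

  allF : List (FMove σ n)
  allF = allWords σ n

  infix 4 _≅_
  _≅_ : WSet σ n → WSet σ n → Set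
  _≅_ = _≈_ σ n

  ≅-refl : ∀ {M} → M ≅ M
  ≅-refl w = refl

  ≅-sym : ∀ {M M′} → M ≅ M′ → M′ ≅ M
  ≅-sym e w = sym (e w)

  ≅-trans : ∀ {M M′ M″} → M ≅ M′ → M′ ≅ M″ → M ≅ M″
  ≅-trans e e′ w = trans (e w) (e′ w)

  move-rc : ∀ f M w → init w ≡ f → move σ n f M w ≡ true
  move-rc f M w i with init w ≟ʷ f
  ... | yes _ = refl
  ... | no i≢f = ⊥-elim (i≢f i)

  move-other : ∀ f M w → init w ≢ f → tail w ≢ f → move σ n f M w ≡ M w
  move-other f M w i≢f t≢f with init w ≟ʷ f
  ... | yes i = ⊥-elim (i≢f i)
  ... | no _ with tail w ≟ʷ f
  ...   | yes t = ⊥-elim (t≢f t)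
  ...   | no _  = refl

  Valid⇒lc⊆ : ∀ {f} {M : WSet σ n} → Valid σ n f M → ∀ w → tail w ≡ f → M w ≡ true
  Valid⇒lc⊆ valid (a ∷ _) refl = valid a

  -- Words of rc f ∖ lc f already in M: each one makes fM smaller than M, so an MDS has none.
  lost : FMove σ n → WSet σ n → Word σ n → Bool
  lost f M w = does (init w ≟ʷ f) ∧ not (does (tail w ≟ʷ f)) ∧ M w

  move-balance : ∀ {f M} → Valid σ n f M → ∀ x w →
    [ M w ]· x + [ does (init w ≟ʷ f) ]· x
    ≡ [ move σ n f M w ]· x + [ does (tail w ≟ʷ f) ]· x + [ lost f M w ]· x
  move-balance {f} {M} valid x w with init w ≟ʷ f | tail w ≟ʷ f | M w in Mw
  ... | _     | yes t | false with () ← trans (sym (Valid⇒lc⊆ {M = M} valid w t)) Mw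
  ... | yes _ | yes _ | true  = sym (+-identityʳ (x + x))
  ... | yes _ | no _  | true  = cong (_+ x) (sym (+-identityʳ x))
  ... | yes _ | no _  | false = sym (trans (+-identityʳ (x + 0)) (+-identityʳ x))
  ... | no _  | yes _ | true  = refl
  ... | no _  | no _  | b     = sym (+-identityʳ ([ b ]· x + 0))

  weight : (Word σ n → ℕ) → WSet σ n → ℕ
  weight φ M = ∑ allW (λ w → [ M w ]· φ w)

  inflow outflow : (Word σ n → ℕ) → FMove σ n → ℕ
  inflow  φ f = ∑ (allFin σ) (λ a → φ (a ∷ f))
  outflow φ f = ∑ (allFin σ) (λ a → φ (f ∷ʳ a))

  lostWeight : (Word σ n → ℕ) → FMove σ n → WSet σ n → ℕ
  lostWeight φ f M = ∑ allW (λ w → [ lost f M w ]· φ w)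

  weight-move : ∀ {f M} → Valid σ n f M → ∀ φ →
    weight φ M + outflow φ f ≡ weight φ (move σ n f M) + inflow φ f + lostWeight φ f M
  weight-move {f} {M} valid φ = begin
    weight φ M + outflow φ f
      ≡⟨ cong (weight φ M +_) (∑-init-δ f φ) ⟨
    weight φ M + ∑ allW (λ w → [ does (init w ≟ʷ f) ]· φ w)
      ≡⟨ ∑-+ allW _ _ ⟨
    ∑ allW (λ w → [ M w ]· φ w + [ does (init w ≟ʷ f) ]· φ w)
      ≡⟨ ∑-cong allW (λ w → move-balance {M = M} valid (φ w) w) ⟩
    ∑ allW (λ w → [ move σ n f M w ]· φ w + [ does (tail w ≟ʷ f) ]· φ w + [ lost f M w ]· φ w)
      ≡⟨ ∑-+ allW _ _ ⟩
    ∑ allW (λ w → [ move σ n f M w ]· φ w + [ does (tail w ≟ʷ f) ]· φ w) + lostWeight φ f M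
      ≡⟨ cong (_+ lostWeight φ f M) (∑-+ allW _ _) ⟩
    weight φ (move σ n f M) + ∑ allW (λ w → [ does (tail w ≟ʷ f) ]· φ w) + lostWeight φ f M
      ≡⟨ cong (λ t → weight φ (move σ n f M) + t + lostWeight φ f M) (∑-tail-δ f φ) ⟩
    weight φ (move σ n f M) + inflow φ f + lostWeight φ f M ∎
    where open ≡-Reasoning

  card-move : ∀ {f M} → Valid σ n f M →
    card σ n M ≡ card σ n (move σ n f M) + lostWeight (λ _ → 1) f M
  card-move {f} {M} valid = +-cancelʳ-≡ (outflow (λ _ → 1) f) _ _
    (trans (weight-move valid (λ _ → 1)) (+-right-comm (card σ n (move σ n f M)) _ _))

  avoids-move⇒avoids : ∀ {f M u u′} → DBEdge σ n u u′ →
    move σ n f M u ≡ false → move σ n f M u′ ≡ false → M u ≡ false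
  avoids-move⇒avoids {f} {M} {u} {u′} u→u′ u∉ u′∉ = trans (sym (move-other f M u i≢f t≢f)) u∉
    where
    i≢f : init u ≢ f
    i≢f i≡f with () ← trans (sym (move-rc f M u i≡f)) u∉
    t≢f : tail u ≢ f
    t≢f t≡f with () ← trans (sym (move-rc f M u′ (trans (sym u→u′) t≡f))) u′∉

  move-preserves-Decycling : ∀ {f M} → Valid σ n f M → Decycling σ n M → Decycling σ n (move σ n f M)
  move-preserves-Decycling {f} {M} _ decycling v vs closed unique (v∉ ∷ vs∉) =
    decycling v vs closed unique (avoids v vs closed (All-++⁺ (v∉ ∷ vs∉) (v∉ ∷ [])))
    where
    avoids : ∀ y ys {z} → Linked (DBEdge σ n) (y ∷ ys ++ [ z ]) →
      All (λ u → move σ n f M u ≡ false) (y ∷ ys ++ [ z ]) → All (λ u → M u ≡ false) (y ∷ ys)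
    avoids y []        (e ∷ [-]) (y∉ ∷ z∉ ∷ [])    = avoids-move⇒avoids e y∉ z∉ ∷ []
    avoids y (y′ ∷ ys) (e ∷ es)  (y∉ ∷ rest@(y′∉ ∷ _)) =
      avoids-move⇒avoids e y∉ y′∉ ∷ avoids y′ ys es rest

  move-preserves-IsMDS : ∀ {f M} → Valid σ n f M → IsMDS σ n M → IsMDS σ n (move σ n f M)
  move-preserves-IsMDS {f} {M} valid (decycling , minimal) =
    move-preserves-Decycling valid decycling ,
    λ M′ d′ → ≤-trans (≤-trans (m≤m+n _ _) (≤-reflexive (sym (card-move valid)))) (minimal M′ d′)

  IsMDS⇒¬lost : ∀ {f M} → Valid σ n f M → IsMDS σ n M → ∀ w → lost f M w ≡ false
  IsMDS⇒¬lost {f} {M} valid (decycling , minimal) w with lost f M w in lw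
  ... | false = refl
  ... | true  = ⊥-elim (<⇒≱ card-drops (minimal _ (move-preserves-Decycling valid decycling)))
    where
    open ≤-Reasoning
    lostWeight-pos : 0 < lostWeight (λ _ → 1) f M
    lostWeight-pos = subst (_< lostWeight (λ _ → 1) f M) (∑-const allW 0)
      (∑-mono-< allW (λ _ → z≤n) (∈-allWords w) (subst (λ b → 0 < [ b ]· 1) (sym lw) (s≤s z≤n)))
    card-drops : card σ n (move σ n f M) < card σ n M
    card-drops = begin-strict
      card σ n (move σ n f M)                              ≡⟨ +-identityʳ _ ⟨
      card σ n (move σ n f M) + 0                          <⟨ +-monoʳ-< _ lostWeight-pos ⟩
      card σ n (move σ n f M) + lostWeight (λ _ → 1) f M   ≡⟨ card-move valid ⟨
      card σ n M                                           ∎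

  move-balance-MDS : ∀ {f M} → Valid σ n f M → IsMDS σ n M → ∀ w →
    [ M w ]· 1 + [ does (init w ≟ʷ f) ]· 1 ≡ [ move σ n f M w ]· 1 + [ does (tail w ≟ʷ f) ]· 1
  move-balance-MDS {f} {M} valid mds w =
    trans (move-balance {M = M} valid 1 w)
          (trans (cong (λ b → [ move σ n f M w ]· 1 + [ does (tail w ≟ʷ f) ]· 1 + [ b ]· 1)
                       (IsMDS⇒¬lost valid mds w)) (+-identityʳ _))

  weight-move-MDS : ∀ {f M} → Valid σ n f M → IsMDS σ n M → ∀ φ →
    weight φ M + outflow φ f ≡ weight φ (move σ n f M) + inflow φ f
  weight-move-MDS {f} {M} valid mds φ =
    trans (weight-move valid φ)
          (trans (cong (weight φ (move σ n f M) + inflow φ f +_) lostWeight≡0) (+-identityʳ _))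
    where
    lostWeight≡0 : lostWeight φ f M ≡ 0
    lostWeight≡0 =
      trans (∑-cong allW (λ w → cong ([_]· φ w) (IsMDS⇒¬lost valid mds w))) (∑-const allW 0)

  Valid-resp : ∀ {f M M′} → M ≅ M′ → Valid σ n f M → Valid σ n f M′
  Valid-resp {f} M≅M′ valid a = trans (sym (M≅M′ (a ∷ f))) (valid a)

  move-resp : ∀ {f M M′} → M ≅ M′ → move σ n f M ≅ move σ n f M′
  move-resp {f} M≅M′ w =
    cong (λ b → if does (init w ≟ʷ f) then true else if does (tail w ≟ʷ f) then false else b) (M≅M′ w)

  IsMDS-resp : ∀ {M M′} → M ≅ M′ → IsMDS σ n M → IsMDS σ n M′
  IsMDS-resp M≅M′ (decycling , minimal) =
    (λ v vs closed unique avoids →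
       decycling v vs closed unique (All.map (λ {w} → trans (M≅M′ w)) avoids)) ,
    λ M″ d″ → subst (_≤ card σ n M″) (∑-cong allW (λ w → cong ([_]· 1) (M≅M′ w))) (minimal M″ d″)

  Walk-≅ˡ : ∀ {M M′ Y fs} → M ≅ M′ → Walk σ n M Y fs → Walk σ n M′ Y fs
  Walk-≅ˡ M≅M′ (done M≅Y)          = done (≅-trans (≅-sym M≅M′) M≅Y)
  Walk-≅ˡ M≅M′ (step f valid walk) = step f (Valid-resp M≅M′ valid) (Walk-≅ˡ (move-resp M≅M′) walk)

  Walk-++ : ∀ {X Y Z ps qs} → Walk σ n X Y ps → Walk σ n Y Z qs → Walk σ n X Z (ps ++ qs)
  Walk-++ (done X≅Y)          walk′ = Walk-≅ˡ (≅-sym X≅Y) walk′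
  Walk-++ (step f valid walk) walk′ = step f valid (Walk-++ walk walk′)

  Walk-preserves-IsMDS : ∀ {X Y fs} → IsMDS σ n X → Walk σ n X Y fs → IsMDS σ n Y
  Walk-preserves-IsMDS mds (done X≅Y)          = IsMDS-resp X≅Y mds
  Walk-preserves-IsMDS mds (step f valid walk) =
    Walk-preserves-IsMDS (move-preserves-IsMDS valid mds) walk

  occ-∷ : ∀ g f fs → occ σ n g (f ∷ fs) ≡ [ does (g ≟ʷ f) ]· 1 + occ σ n g fs
  occ-∷ g f fs with f ≟ʷ g | g ≟ʷ f
  ... | yes _   | yes _   = refl
  ... | no _    | no _    = refl
  ... | yes f≡g | no g≢f  = ⊥-elim (g≢f (sym f≡g))
  ... | no f≢g  | yes g≡f = ⊥-elim (f≢g (sym g≡f))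

  occ-self : ∀ f fs → 1 ≤ occ σ n f (f ∷ fs)
  occ-self f fs = subst (1 ≤_) (sym occ-f) (s≤s z≤n)
    where
    occ-f : occ σ n f (f ∷ fs) ≡ suc (occ σ n f fs)
    occ-f = trans (occ-∷ f f fs) (cong (λ b → [ b ]· 1 + occ σ n f fs) (dec-true (f ≟ʷ f) refl))

  occ-++ : ∀ g xs ys → occ σ n g (xs ++ ys) ≡ occ σ n g xs + occ σ n g ys
  occ-++ g xs ys =
    trans (cong length (filter-++ (λ h → h ≟ʷ g) xs ys)) (length-++ (filter (λ h → h ≟ʷ g) xs))

  length≡∑occ : ∀ fs → length fs ≡ ∑ allF (λ g → occ σ n g fs)
  length≡∑occ []       = sym (∑-const allF 0)
  length≡∑occ (f ∷ fs) = sym (begin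
    ∑ allF (λ g → occ σ n g (f ∷ fs))                   ≡⟨ ∑-cong allF (λ g → occ-∷ g f fs) ⟩
    ∑ allF (λ g → [ does (g ≟ʷ f) ]· 1 + occ σ n g fs)  ≡⟨ ∑-+ allF _ _ ⟩
    ∑ allF (λ g → [ does (g ≟ʷ f) ]· 1) + ∑ allF (λ g → occ σ n g fs)
      ≡⟨ cong₂ _+_ (∑-allWords-δ f (λ _ → 1)) (sym (length≡∑occ fs)) ⟩
    suc (length fs)                                           ∎)
    where open ≡-Reasoning

  occ-uniform⇒length : ∀ fs α → (∀ g → occ σ n g fs ≡ α) → length fs ≡ α * σ ^ n
  occ-uniform⇒length fs α uniform = begin
    length fs                        ≡⟨ length≡∑occ fs ⟩
    ∑ allF (λ g → occ σ n g fs)      ≡⟨ ∑-cong allF uniform ⟩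
    ∑ allF (λ _ → α)                 ≡⟨ ∑-const allF α ⟩
    α * length allF                  ≡⟨ cong (α *_) (length-allWords n) ⟩
    α * σ ^ n                        ∎
    where open ≡-Reasoning

  walk-balance : ∀ {X Y fs} → IsMDS σ n X → Walk σ n X Y fs → ∀ w →
    occ σ n (init w) fs + [ X w ]· 1 ≡ occ σ n (tail w) fs + [ Y w ]· 1
  walk-balance mds (done X≅Y) w = cong ([_]· 1) (X≅Y w)
  walk-balance {X} {Y} {f ∷ fs} mds (step f valid walk) w = begin
    occ σ n (init w) (f ∷ fs) + [ X w ]· 1  ≡⟨ cong (_+ [ X w ]· 1) (occ-∷ (init w) f fs) ⟩
    eᵢ + oᵢ + [ X w ]· 1                    ≡⟨ +-rotate eᵢ oᵢ ([ X w ]· 1) ⟩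
    oᵢ + ([ X w ]· 1 + eᵢ)                  ≡⟨ cong (oᵢ +_) (move-balance-MDS valid mds w) ⟩
    oᵢ + ([ move σ n f X w ]· 1 + eₜ)       ≡⟨ +-assoc oᵢ _ eₜ ⟨
    oᵢ + [ move σ n f X w ]· 1 + eₜ
      ≡⟨ cong (_+ eₜ) (walk-balance (move-preserves-IsMDS valid mds) walk w) ⟩
    oₜ + [ Y w ]· 1 + eₜ                    ≡⟨ +-swap-last oₜ ([ Y w ]· 1) eₜ ⟩
    eₜ + oₜ + [ Y w ]· 1                    ≡⟨ cong (_+ [ Y w ]· 1) (occ-∷ (tail w) f fs) ⟨
    occ σ n (tail w) (f ∷ fs) + [ Y w ]· 1  ∎
    where
    open ≡-Reasoning
    oᵢ oₜ eᵢ eₜ : ℕ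
    oᵢ = occ σ n (init w) fs
    oₜ = occ σ n (tail w) fs
    eᵢ = [ does (init w ≟ʷ f) ]· 1
    eₜ = [ does (tail w ≟ʷ f) ]· 1

  closed-walk⇒occ-uniform : ∀ {X Y fs} → IsMDS σ n X → Walk σ n X Y fs → X ≅ Y →
    ∀ f g → occ σ n f fs ≡ occ σ n g fs
  closed-walk⇒occ-uniform {X} {Y} {fs} mds walk X≅Y =
    shift-invariant⇒constant n (λ g → occ σ n g fs) shift
    where
    shift : ∀ f a → occ σ n f fs ≡ occ σ n (tail (f ∷ʳ a)) fs
    shift f a = subst (λ v → occ σ n v fs ≡ occ σ n (tail (f ∷ʳ a)) fs) (init-∷ʳ a f)
      (+-cancelʳ-≡ _ _ _ (trans (walk-balance mds walk (f ∷ʳ a))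
        (cong (λ b → occ σ n (tail (f ∷ʳ a)) fs + [ b ]· 1) (sym (X≅Y (f ∷ʳ a))))))

  closed-walk-length : ∀ {X Y fs} → IsMDS σ n X → Walk σ n X Y fs → X ≅ Y → fs ≢ [] →
    ∃[ α ] (1 ≤ α × length fs ≡ α * σ ^ n)
  closed-walk-length {fs = []}     _   _    _   nonempty = ⊥-elim (nonempty refl)
  closed-walk-length {fs = f ∷ fs} mds walk X≅Y _ =
    occ σ n f (f ∷ fs) , occ-self f fs ,
    occ-uniform⇒length (f ∷ fs) _ (λ g → closed-walk⇒occ-uniform mds walk X≅Y g f)

  closed-walk-occ : ∀ {X Y fs} α .{{_ : NonZero (σ ^ n)}} → IsMDS σ n X → Walk σ n X Y fs →
    X ≅ Y → length fs ≡ α * σ ^ n → ∀ f → occ σ n f fs ≡ α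
  closed-walk-occ {fs = fs} α mds walk X≅Y len f = *-cancelʳ-≡ _ _ (σ ^ n)
    (trans (sym (occ-uniform⇒length fs _ (λ g → closed-walk⇒occ-uniform mds walk X≅Y g f))) len)

  AtMostOnce EachOnce : List (FMove σ n) → Set
  AtMostOnce fs = ∀ g → occ σ n g fs ≤ 1
  EachOnce   fs = ∀ g → occ σ n g fs ≡ 1

  ∑-ones : ∑ allF (λ _ → 1) ≡ σ ^ n
  ∑-ones = trans (∑-const allF 1) (trans (*-identityˡ _) (length-allWords n))

  AtMostOnce⇒length≤ : ∀ fs → AtMostOnce fs → length fs ≤ σ ^ n
  AtMostOnce⇒length≤ fs once = subst₂ _≤_ (sym (length≡∑occ fs)) ∑-ones (∑-mono-≤ allF once)

  unused⇒length< : ∀ fs {g} → AtMostOnce fs → occ σ n g fs ≡ 0 → length fs < σ ^ n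
  unused⇒length< fs {g} once unused = subst₂ _<_ (sym (length≡∑occ fs)) ∑-ones
    (∑-mono-< allF once (∈-allWords g) (subst (_< 1) (sym unused) (s≤s z≤n)))

  AtMostOnce-snoc : ∀ us {g} → AtMostOnce us → occ σ n g us ≡ 0 → AtMostOnce (us ++ [ g ])
  AtMostOnce-snoc us {g} once unused h = subst (_≤ 1) (sym occ-h) (bound (h ≟ʷ g))
    where
    occ-h : occ σ n h (us ++ [ g ]) ≡ occ σ n h us + [ does (h ≟ʷ g) ]· 1
    occ-h = trans (occ-++ h us [ g ]) (cong (occ σ n h us +_) (trans (occ-∷ h g []) (+-identityʳ _)))
    bound : (d : Dec (h ≡ g)) → occ σ n h us + [ does d ]· 1 ≤ 1
    bound (yes refl) = subst (λ o → o + 1 ≤ 1) (sym unused) ≤-refl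
    bound (no _)     = subst (_≤ 1) (sym (+-identityʳ _)) (once h)

  []·1-injective : ∀ {b c} → [ b ]· 1 ≡ [ c ]· 1 → b ≡ c
  []·1-injective {false} {false} _ = refl
  []·1-injective {true}  {true}  _ = refl

  EachOnce-closes : ∀ {M X us} → IsMDS σ n M → Walk σ n M X us → EachOnce us → M ≅ X
  EachOnce-closes {M} {X} {us} mds walk each w = []·1-injective (+-cancelˡ-≡ 1 _ _ (begin
    1 + [ M w ]· 1                      ≡⟨ cong (_+ [ M w ]· 1) (each (init w)) ⟨
    occ σ n (init w) us + [ M w ]· 1    ≡⟨ walk-balance mds walk w ⟩
    occ σ n (tail w) us + [ X w ]· 1    ≡⟨ cong (_+ [ X w ]· 1) (each (tail w)) ⟩
    1 + [ X w ]· 1                      ∎))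
    where open ≡-Reasoning

  Valid? : ∀ f M → Dec (Valid σ n f M)
  Valid? f M = all? (λ a → M (a ∷ f) ≟ᵇ true)

  unused? : ∀ us → Dec (∃[ g ] occ σ n g us ≡ 0)
  unused? us = map′ satisfied (λ (g , unused) → lose (∈-allWords g) unused)
                    (any? (λ g → occ σ n g us ≟ 0) allF)

  -- Otherwise every word outside X with an unused suffix has, by walk-balance, a
  -- predecessor of the same kind, and D_k ∖ X would contain a cycle.
  unused-move-valid : ∀ {M X us g₀} → IsMDS σ n M → Walk σ n M X us → occ σ n g₀ us ≡ 0 →
    ∃[ g ] (occ σ n g us ≡ 0 × Valid σ n g X)
  unused-move-valid {X = X} {us} {g₀} mds walk g₀-unused
    with any? (λ g → (occ σ n g us ≟ 0) ×-dec Valid? g X) allF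
  ... | yes found = satisfied found
  ... | no none   = ⊥-elim (acyclic (predecessor-closed⇒cycle _≟ʷ_ ∈-allWords (DBEdge σ n) predecessor
                                        (proj₁ start ∷ g₀) (proj₂ start , g₀-unused)))
    where
    invalid-witness : ∀ g → occ σ n g us ≡ 0 → ∃[ a ] X (a ∷ g) ≡ false
    invalid-witness g unused with Valid? g X
    ... | yes valid = ⊥-elim (none (lose (∈-allWords g) (unused , valid)))
    ... | no ¬valid with a , Xag≢true ← ¬∀⟶∃¬ σ _ (λ a → X (a ∷ g) ≟ᵇ true) ¬valid =
      a , ¬-not Xag≢true
    start : ∃[ a ] X (a ∷ g₀) ≡ false
    start = invalid-witness g₀ g₀-unused
    Avoiding : Word σ n → Set
    Avoiding w = X w ≡ false × occ σ n (tail w) us ≡ 0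
    predecessor : ∀ w → Avoiding w → ∃[ u ] (Avoiding u × DBEdge σ n u w)
    predecessor w (w∉X , tail-unused) = proj₁ witness ∷ init w , (proj₂ witness , init-unused) , refl
      where
      init-unused : occ σ n (init w) us ≡ 0
      init-unused = m+n≡0⇒m≡0 _
        (trans (walk-balance mds walk w) (cong₂ (λ o b → o + [ b ]· 1) tail-unused w∉X))
      witness : ∃[ a ] X (a ∷ init w) ≡ false
      witness = invalid-witness (init w) init-unused
    acyclic : CycleWithin (DBEdge σ n) Avoiding → ⊥
    acyclic (v , vs , closed , unique , avoids) =
      proj₁ (Walk-preserves-IsMDS mds walk) v vs closed unique (All.map proj₁ avoids)

  extend-to-tour : ∀ {M X us} → IsMDS σ n M → Walk σ n M X us → AtMostOnce us →
    ∃[ vs ] (Walk σ n X M vs × EachOnce (us ++ vs))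
  extend-to-tour {M} {us = us} mds walk once = go (σ ^ n) walk once (m≤n+m (σ ^ n) (length us))
    where
    fuel-snoc : ∀ {k g} us → σ ^ n ≤ length us + suc k → σ ^ n ≤ length (us ++ [ g ]) + k
    fuel-snoc {k} us =
      subst (σ ^ n ≤_) (sym (trans (cong (_+ k) (length-++ us)) (+-assoc (length us) 1 k)))
    go : ∀ k {X us} → Walk σ n M X us → AtMostOnce us → σ ^ n ≤ length us + k →
         ∃[ vs ] (Walk σ n X M vs × EachOnce (us ++ vs))
    go k {X} {us} walk once fuel with unused? us
    ... | no none = [] , done (≅-sym (EachOnce-closes mds walk each)) ,
                    λ g → trans (cong (occ σ n g) (++-identityʳ us)) (each g)
      where
      each : EachOnce us
      each g = ≤-antisym (once g) (n≢0⇒n>0 (λ unused → none (g , unused)))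
    ... | yes (g₀ , g₀-unused) with k
    ...   | zero =
      ⊥-elim (<⇒≱ (unused⇒length< us once g₀-unused) (subst (σ ^ n ≤_) (+-identityʳ _) fuel))
    ...   | suc k with g , g-unused , g-valid ← unused-move-valid mds walk g₀-unused
                  with vs , back , each ← go k (Walk-++ walk (step g g-valid (done ≅-refl)))
                                             (AtMostOnce-snoc us once g-unused) (fuel-snoc us fuel) =
      g ∷ vs , step g g-valid back ,
      λ h → trans (cong (occ σ n h) (sym (++-assoc us [ g ] vs))) (each h)

  reverse-move : ∀ {f M} → IsMDS σ n M → Valid σ n f M → ∃[ vs ] Walk σ n (move σ n f M) M vs
  reverse-move {f} mds valid
    with vs , back , _ ← extend-to-tour mds (step f valid (done ≅-refl))
                                        (AtMostOnce-snoc [] {f} (λ _ → z≤n) refl)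
    = vs , back

  Conn⇒walks : ∀ {X Y} → IsMDS σ n X → Conn σ n X Y →
    (∃[ ps ] Walk σ n X Y ps) × (∃[ qs ] Walk σ n Y X qs)
  Conn⇒walks mds (here X≅Y) = ([] , done X≅Y) , ([] , done (≅-sym X≅Y))
  Conn⇒walks mds (fwd f valid mds′ conn)
    with (ps , out) , (qs , back) ← Conn⇒walks mds′ conn | bs , undo ← reverse-move mds valid
    = (f ∷ ps , step f valid out) , (qs ++ bs , Walk-++ back undo)
  Conn⇒walks mds (bwd f M′ mds′ valid X≅fM′ conn)
    with (ps , out) , (qs , back) ← Conn⇒walks mds′ conn | bs , undo ← reverse-move mds′ valid
    = (bs ++ ps , Walk-++ (Walk-≅ˡ (≅-sym X≅fM′) undo) out) ,
      (qs ++ [ f ] , Walk-++ back (step f valid (done (≅-sym X≅fM′))))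

  strongly-connected : ∀ {M₀ M M′} → IsMDS σ n M₀ → InComp σ n M₀ M → InComp σ n M₀ M′ →
    ∃[ fs ] Walk σ n M M′ fs
  strongly-connected mds₀ (_ , conn) (_ , conn′)
    with _ , (qs , back) ← Conn⇒walks mds₀ conn | (ps , out) , _ ← Conn⇒walks mds₀ conn′
    = qs ++ ps , Walk-++ back out

  nodes-reachable : ∀ {X Y fs} (walk : Walk σ n X Y fs) →
    All (λ B → ∃[ ps ] (length ps < length fs × Walk σ n X B ps)) (nodes σ n walk)
  nodes-reachable (done _)            = []
  nodes-reachable (step f valid walk) =
    ([] , s≤s z≤n , done ≅-refl) ∷
    All.map (λ (ps , shorter , prefix) → f ∷ ps , s≤s shorter , step f valid prefix)
            (nodes-reachable walk)

  AtMostOnce⇒nodes-distinct : ∀ {X Y fs} → IsMDS σ n X → (walk : Walk σ n X Y fs) →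
    AtMostOnce fs → AllPairs (λ A B → ¬ A ≅ B) (nodes σ n walk)
  AtMostOnce⇒nodes-distinct mds (done _) once = []
  AtMostOnce⇒nodes-distinct {X} {fs = f ∷ fs} mds (step f valid walk) once =
    All.map (λ (ps , shorter , prefix) → no-return ps shorter prefix) (nodes-reachable walk) ∷
    AtMostOnce⇒nodes-distinct (move-preserves-IsMDS valid mds) walk
      (λ g → ≤-trans (subst (occ σ n g fs ≤_) (sym (occ-∷ g f fs)) (m≤n+m _ _)) (once g))
    where
    no-return : ∀ {B} ps → length ps < length fs → Walk σ n (move σ n f X) B ps → ¬ X ≅ B
    no-return ps shorter prefix X≅B
      with α , 1≤α , len ← closed-walk-length mds (step f valid prefix) X≅B (λ ())
      = <⇒≱ (≤-trans (s≤s shorter) (AtMostOnce⇒length≤ (f ∷ fs) once)) (begin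
          σ ^ n          ≡⟨ *-identityˡ (σ ^ n) ⟨
          1 * σ ^ n      ≤⟨ *-monoˡ-≤ (σ ^ n) 1≤α ⟩
          α * σ ^ n      ≡⟨ len ⟨
          length (f ∷ ps) ∎)
      where open ≤-Reasoning

  tour-cycle : ∀ {M} .{{_ : NonZero (σ ^ n)}} → IsMDS σ n M →
    ∃[ fs ] (Cycle σ n M fs × length fs ≡ σ ^ n)
  tour-cycle mds with fs , walk , each ← extend-to-tour mds (done ≅-refl) (λ _ → z≤n) =
    fs , (walk , nonempty , AtMostOnce⇒nodes-distinct mds walk (≤-reflexive ∘ each)) , len
    where
    len : length fs ≡ σ ^ n
    len = trans (occ-uniform⇒length fs 1 each) (*-identityˡ _)
    nonempty : fs ≢ []
    nonempty refl = ≢-nonZero⁻¹ (σ ^ n) (sym len)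

-- The in-tree of D_(k-1) rooted at oⁿ in which v points to tail (v ∷ʳ o): flow puts the
-- size of the subtree below v on the edge v ∷ʳ o, so every vertex but the root has net
-- outflow 1; isRoot v is 1 exactly for v = oⁿ.
module SpanningTree {σ : ℕ} (o : Fin σ) where

  subtreeSize : ∀ {L} → Vec (Fin σ) L → ℕ
  subtreeSize {zero}  _ = 1
  subtreeSize {suc L} v = 1 + [ does (last v ≟ᶠ o) ]· (σ * subtreeSize (init v))

  isRoot : ∀ {L} → Vec (Fin σ) L → ℕ
  isRoot {zero}  _ = 1
  isRoot {suc L} v = [ does (last v ≟ᶠ o) ]· isRoot (init v)

  flow : ∀ {L} → Vec (Fin σ) (suc L) → ℕ
  flow w = [ does (last w ≟ᶠ o) ]· subtreeSize (init w)

  ∑-subtreeSize-∷ : ∀ {L} (g : Vec (Fin σ) L) →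
    ∑ (allFin σ) (λ a → subtreeSize (a ∷ g)) ≡ σ * subtreeSize g + isRoot g * σ ^ suc L
  ∑-subtreeSize-∷ {zero} [] = begin
    ∑ (allFin σ) (λ a → 1 + [ does (a ≟ᶠ o) ]· (σ * 1))           ≡⟨ ∑-+ (allFin σ) _ _ ⟩
    ∑ (allFin σ) (λ _ → 1) + ∑ (allFin σ) (λ a → [ does (a ≟ᶠ o) ]· (σ * 1))
      ≡⟨ cong₂ _+_ (∑-allFin-const σ 1) (∑-allFin-δ σ o (λ _ → σ * 1)) ⟩
    1 * σ + σ * 1                                                ≡⟨ arith σ ⟩
    σ * 1 + 1 * (σ * 1)                                          ∎
    where
    open ≡-Reasoning
    arith : ∀ x → 1 * x + x * 1 ≡ x * 1 + 1 * (x * 1)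
    arith = solve-∀
  ∑-subtreeSize-∷ {suc L} g with does (last g ≟ᶠ o)
  ... | false = trans (∑-allFin-const σ 1) (trans (*-comm 1 σ) (sym (+-identityʳ (σ * 1))))
  ... | true  = begin
    ∑ (allFin σ) (λ a → 1 + σ * subtreeSize (a ∷ init g))
      ≡⟨ ∑-+ (allFin σ) _ _ ⟩
    ∑ (allFin σ) (λ _ → 1) + ∑ (allFin σ) (λ a → σ * subtreeSize (a ∷ init g))
      ≡⟨ cong₂ _+_ (∑-allFin-const σ 1) (∑-* (allFin σ) σ _) ⟩
    1 * σ + σ * ∑ (allFin σ) (λ a → subtreeSize (a ∷ init g))
      ≡⟨ cong (λ t → 1 * σ + σ * t) (∑-subtreeSize-∷ (init g)) ⟩
    1 * σ + σ * (σ * subtreeSize (init g) + isRoot (init g) * σ ^ suc L)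
      ≡⟨ arith σ (subtreeSize (init g)) (isRoot (init g)) (σ ^ L) ⟩
    σ * (1 + σ * subtreeSize (init g)) + isRoot (init g) * σ ^ suc (suc L) ∎
    where
    open ≡-Reasoning
    arith : ∀ x s r p → 1 * x + x * (x * s + r * (x * p)) ≡ x * (1 + x * s) + r * (x * (x * p))
    arith = solve-∀

  outflow-subtreeSize : ∀ {L} (f : Vec (Fin σ) L) →
    ∑ (allFin σ) (λ a → flow (f ∷ʳ a)) ≡ subtreeSize f
  outflow-subtreeSize f = trans (∑-cong (allFin σ) flow-∷ʳ) (∑-allFin-δ σ o (λ _ → subtreeSize f))
    where
    flow-∷ʳ : ∀ a → flow (f ∷ʳ a) ≡ [ does (a ≟ᶠ o) ]· subtreeSize f
    flow-∷ʳ a rewrite last-∷ʳ a f | init-∷ʳ a f = refl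

  inflow-subtreeSize : ∀ {L} (f : Vec (Fin σ) L) →
    1 + ∑ (allFin σ) (λ a → flow (a ∷ f)) ≡ subtreeSize f + isRoot f * σ ^ L
  inflow-subtreeSize []      = cong suc (∑-allFin-δ σ o (λ _ → 1))
  inflow-subtreeSize (b ∷ f) with does (last (b ∷ f) ≟ᶠ o)
  ... | false = cong suc (∑-allFin-const σ 0)
  ... | true  = cong suc (∑-subtreeSize-∷ (init (b ∷ f)))

[1+m]%n≡[1+m%n]%n : ∀ {N} .{{_ : NonZero N}} → 1 < N → ∀ m → suc m % N ≡ suc (m % N) % N
[1+m]%n≡[1+m%n]%n {N} 1<N m = trans (%-distribˡ-+ 1 m N) (cong (λ r → (r + m % N) % N) (m<n⇒m%n≡m 1<N))

m%n≢[1+m]%n : ∀ {N} .{{_ : NonZero N}} → 1 < N → ∀ m → m % N ≢ suc m % N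
m%n≢[1+m]%n {N} 1<N m eq with m≤n⇒m<n∨m≡n (m%n<n m N)
... | inj₁ 1+r<N = 1+n≢n (sym (trans eq (trans ([1+m]%n≡[1+m%n]%n 1<N m) (m<n⇒m%n≡m 1+r<N))))
... | inj₂ 1+r≡N = <-irrefl (trans (sym (cong suc r≡0)) 1+r≡N) 1<N
  where
  r≡0 : m % N ≡ 0
  r≡0 = trans eq (trans ([1+m]%n≡[1+m%n]%n 1<N m) (trans (cong (_% N) 1+r≡N) (n%n≡0 N)))

module Colouring (σ n : ℕ) (o : Fin σ) .{{_ : NonZero (σ ^ n)}} where
  open MDSGraph σ n
  open SpanningTree o

  potential : WSet σ n → ℕ
  potential = weight flow

  colour : WSet σ n → Fin (σ ^ n)
  colour M = potential M mod σ ^ n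

  colour-resp : ∀ {M M′} → M ≅ M′ → colour M ≡ colour M′
  colour-resp M≅M′ = cong (_mod σ ^ n) (∑-cong allW (λ w → cong ([_]· flow w) (M≅M′ w)))

  potential-move : ∀ {f M} → Valid σ n f M → IsMDS σ n M →
    potential (move σ n f M) + isRoot f * σ ^ n ≡ suc (potential M)
  potential-move {f} {M} valid mds = +-cancelʳ-≡ (subtreeSize f) _ _ (begin
    potential (move σ n f M) + isRoot f * σ ^ n + subtreeSize f
      ≡⟨ +-assoc (potential (move σ n f M)) (isRoot f * σ ^ n) (subtreeSize f) ⟩
    potential (move σ n f M) + (isRoot f * σ ^ n + subtreeSize f)
      ≡⟨ cong (potential (move σ n f M) +_)
              (trans (inflow-subtreeSize f) (+-comm (subtreeSize f) _)) ⟨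
    potential (move σ n f M) + suc (inflow flow f)
      ≡⟨ +-suc _ _ ⟩
    suc (potential (move σ n f M) + inflow flow f)
      ≡⟨ cong suc (weight-move-MDS valid mds flow) ⟨
    suc (potential M + outflow flow f)
      ≡⟨ cong (λ t → suc (potential M + t)) (outflow-subtreeSize f) ⟩
    suc (potential M) + subtreeSize f ∎)
    where open ≡-Reasoning

  colour-move : 1 < σ ^ n → ∀ {f M} → Valid σ n f M → IsMDS σ n M →
    colour M ≢ colour (move σ n f M)
  colour-move 1<N {f} {M} valid mds same = m%n≢[1+m]%n 1<N (potential M) (begin
    potential M % σ ^ n
      ≡⟨ fromℕ<-injective _ _ (m%n<n _ _) (m%n<n _ _) same ⟩
    potential (move σ n f M) % σ ^ n
      ≡⟨ [m+kn]%n≡m%n _ (isRoot f) (σ ^ n) ⟨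
    (potential (move σ n f M) + isRoot f * σ ^ n) % σ ^ n
      ≡⟨ cong (_% σ ^ n) (potential-move valid mds) ⟩
    suc (potential M) % σ ^ n ∎)
    where open ≡-Reasoning

proposition3 : (σ n : ℕ) → 2 ≤ σ → 1 ≤ n →
  (M₀ : WSet σ n) → IsMDS σ n M₀ →
  ((M M' : WSet σ n) → InComp σ n M₀ M → InComp σ n M₀ M' →
      ∃[ fs ] Walk σ n M M' fs)
  × ((M : WSet σ n) (fs : List (FMove σ n)) → InComp σ n M₀ M → Cycle σ n M fs →
      ∃[ α ] (1 ≤ α × length fs ≡ α * σ ^ n))
  × ((M : WSet σ n) (fs : List (FMove σ n)) (α : ℕ) → InComp σ n M₀ M →
      Cycle σ n M fs → length fs ≡ α * σ ^ n →
      (f : FMove σ n) → occ σ n f fs ≡ α)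
  × ((M : WSet σ n) → InComp σ n M₀ M →
      ∃[ fs ] (Cycle σ n M fs × length fs ≡ σ ^ n))
  × (Σ (WSet σ n → Fin (σ ^ n)) λ c →
      ((M M' : WSet σ n) → InComp σ n M₀ M → InComp σ n M₀ M' →
          _≈_ σ n M M' → c M ≡ c M')
      × ((M : WSet σ n) (f : FMove σ n) → InComp σ n M₀ M → Valid σ n f M →
          ¬ c M ≡ c (move σ n f M)))
proposition3 σ@(suc _) n 1<σ 0<n M₀ mds₀ =
  (λ M M′ → strongly-connected mds₀) ,
  (λ M fs (mds , _) (walk , nonempty , _) → closed-walk-length mds walk ≅-refl nonempty) ,
  (λ M fs α (mds , _) (walk , _ , _) len → closed-walk-occ α mds walk ≅-refl len) ,
  (λ M (mds , _) → tour-cycle mds) ,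
  (colour , (λ M M′ _ _ → colour-resp) , λ M f (mds , _) valid → colour-move 1<σ^n valid mds)
  where
  1<σ^n : 1 < σ ^ n
  1<σ^n = ^-monoʳ-< σ 1<σ 0<n
  instance
    σ^n≢0 : NonZero (σ ^ n)
    σ^n≢0 = >-nonZero (<-trans (s≤s z≤n) 1<σ^n)
  open MDSGraph σ n
  open Colouring σ n fzero
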